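{- If $G$ is an outerplanar graph with an $n$-vertex path, then $G$ contains an induced path of size $\frac{\log n}{2}(1-o(1))$.
   Context: An outerplanar graph is a graph that can be drawn in the plane without crossing edges and with all vertices on the outer face. The size of a path is its number of vertices. Logarithms are base 2; $o(1)$ is with respect to $n\to\infty$. -}

module Defs where

open import Data.Nat using (ℕ; suc; _<_; _≤_)
open import Data.Fin using (Fin; toℕ)
open import Data.Bool using (Bool; true; false)
open import Data.Product using (Σ; ∃; _×_)
open import Data.Empty using (⊥)
open import Relation.Binary.PropositionalEquality using (_≡_)
open import Relation.Nullary using (¬_)
open import Function.Definitions using (Injective)

record Graph (V : ℕ) : Set where
  field
    adj   : Fin V → Fin V → Bool
    sym   : ∀ u v → adj u v ≡ adj v u
    irrefl : ∀ v → adj v v ≡ false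
open Graph public

-- G is outerplanar: the vertices can be placed on a circle (in the cyclic
-- order given by the bijection pos : Fin V → Fin V) so that all edges, drawn
-- as straight chords, are pairwise non-crossing.
Outerplanar : {V : ℕ} → Graph V → Set
Outerplanar {V} G =
  Σ (Fin V → Fin V) λ pos → Injective _≡_ _≡_ pos ×
    (∀ u v x y → adj G u v ≡ true → adj G x y ≡ true →
       ¬ (toℕ (pos u) < toℕ (pos x) × toℕ (pos x) < toℕ (pos v)
          × toℕ (pos v) < toℕ (pos y)))

Consecutive : {n : ℕ} → Fin n → Fin n → Set
Consecutive {n} i j = (suc (toℕ i) ≡ toℕ j) Data.Sum.⊎ (suc (toℕ j) ≡ toℕ i)
  where import Data.Sum

HasPath : {V : ℕ} → Graph V → ℕ → Set
HasPath {V} G n =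
  Σ (Fin n → Fin V) λ p → Injective _≡_ _≡_ p ×
    (∀ i j → Consecutive i j → adj G (p i) (p j) ≡ true)

HasInducedPath : {V : ℕ} → Graph V → ℕ → Set
HasInducedPath {V} G k =
  Σ (Fin k → Fin V) λ q → Injective _≡_ _≡_ q ×
    (∀ i j → (adj G (q i) (q j) ≡ true → Consecutive i j)
           × (Consecutive i j → adj G (q i) (q j) ≡ true))

{-# OPTIONS --safe #-}
module Submission where

-- Number the vertices of the path 0, …, n - 1. On the circle of the outerplanar drawing, whether a
-- chord separates two points is a parity that adds up along walks, so vertex-disjoint walks never
-- separate each other's ends; as exactly one of the three pairings of four points crosses, no two
-- interleaved edges a b, c d (a < c < b < d) can lie under an edge t z with t ≤ a and d ≤ z.
-- In such a pocket [lo, hi], let z be the last neighbour of lo below hi and recurse on [lo, z] and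
-- [z, hi]: this gives induced paths inside the pocket starting at lo and at hi, of sizes p and q, with
-- hi - lo ≤ 2 ^ (p + q), since lo extends the left path of [z, hi] and the right path of [lo, z]
-- climbs on to hi along last neighbours. Walking from 0 along last neighbours cuts the whole path
-- into pockets, and the same bookkeeping yields n ≤ 2 ^ (2 k + 1) for the largest size k found.

open import Defs renaming (sym to adj-sym; irrefl to adj-irrefl)
open import Data.Nat using (ℕ; zero; suc; _+_; _*_; _^_; _∸_; _≤_; _<_; z≤n; s≤s; _<?_; _<ᵇ_;
                            _≤′_; ≤′-refl; ≤′-step)
open import Data.Product using (Σ; ∃; _×_; _,_; proj₁; proj₂)

open import Algebra.Bundles using (CommutativeRing)
open import Data.Bool.Base using (Bool; true; false; not; _xor_)
open import Data.Bool.Properties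
  using (xor-∧-commutativeRing; xor-assoc; xor-comm; xor-same; xor-annihilates-not; xor-inverseˡ; ¬-not)
open import Data.Empty using (⊥; ⊥-elim)
open import Data.Fin using (Fin; toℕ; zero; suc)
open import Data.Fin.Properties using (toℕ-injective; toℕ-fromℕ<)
open import Data.List using (List; []; _∷_; length; lookup)
open import Data.List.Membership.Propositional using (_∈_; _∉_)
open import Data.List.Membership.Propositional.Properties using (∈-lookup)
open import Data.List.Relation.Binary.Disjoint.Propositional using (Disjoint)
import Data.List.Relation.Binary.Disjoint.Propositional.Properties as Disjoint
open import Data.List.Relation.Unary.All using (All; []; _∷_)
import Data.List.Relation.Unary.All as All
open import Data.List.Relation.Unary.Any using (here; there)
open import Data.Nat.DivMod using (_mod_; m<n⇒m%n≡m)
open import Data.Nat.Induction using (<-wellFounded)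
open import Data.Nat.Properties
  using (<-cmp; <⇒≱; <⇒≯; <⇒≢; <-trans; ≤-refl; ≤-reflexive; ≤-trans; <-≤-trans; ≤-<-trans; <⇒≤;
         n<1+n; m≤n⇒m≤1+n; m<n⇒m<1+n; ≤⇒≤′; ≤′⇒≤; ≤-pred; m≤n⇒m<n∨m≡n; ≤∧≢⇒<; ≮⇒≥;
         m+[n∸m]≡n; m+n∸n≡m; +-identityʳ; suc-injective; *-suc; +-mono-≤; +-monoˡ-≤; +-mono-≤-<;
         +-mono-<-≤; ∸-monoˡ-<; ∸-monoʳ-<; ^-monoˡ-≤; ^-monoʳ-≤; ^-monoʳ-<; ^-*-assoc; m^n>0;
         ≤-totalOrder; module ≤-Reasoning)
open import Data.List.Extrema.Core ≤-totalOrder using (⊔ᴸ; ⊔ᴸ-presᵒ-v≤)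
open import Data.Sum using (_⊎_; inj₁; inj₂; [_,_])
import Data.Sum as Sum
open import Data.Unit using (⊤; tt)
open import Function using (_∘_)
open import Function.Bundles using (_⇔_; mk⇔; Equivalence)
open import Function.Definitions using (Injective)
open import Induction.WellFounded using (Acc; acc)
open import Relation.Binary.Definitions using (tri<; tri≈; tri>)
open import Relation.Binary.PropositionalEquality
  using (_≡_; _≢_; refl; sym; trans; cong; cong₂; ≢-sym; module ≡-Reasoning)
open import Relation.Nullary using (contradiction)
open import Relation.Nullary.Decidable using (dec-true; dec-false)
open import Relation.Unary using (_⊆_)
open import Algebra.Properties.CommutativeSemigroup
  (CommutativeRing.+-commutativeSemigroup xor-∧-commutativeRing) using (interchange)

xor-telescope : ∀ x y z → (x xor y) xor (y xor z) ≡ x xor z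
xor-telescope x y z = begin
  (x xor y) xor (y xor z)  ≡⟨ xor-assoc x y (y xor z) ⟩
  x xor (y xor (y xor z))  ≡⟨ cong (x xor_) (sym (xor-assoc y y z)) ⟩
  x xor ((y xor y) xor z)  ≡⟨ cong (λ b → x xor (b xor z)) (xor-same y) ⟩
  x xor z                  ∎
  where open ≡-Reasoning

xor-cancelʳ : ∀ x y z → (x xor z) xor (y xor z) ≡ x xor y
xor-cancelʳ x y z = trans (cong ((x xor z) xor_) (xor-comm y z)) (xor-telescope x z y)

-- The circle is cut open into 0, 1, 2, …: between α β ξ holds iff min α β < ξ ≤ max α β, so for
-- distinct points, separates α β μ ν holds iff the chord α β separates μ from ν.
between : ℕ → ℕ → ℕ → Bool
between α β ξ = (α <ᵇ ξ) xor (β <ᵇ ξ)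

separates : ℕ → ℕ → ℕ → ℕ → Bool
separates α β μ ν = between α β μ xor between α β ν

separates-refl : ∀ α μ ν → separates α α μ ν ≡ false
separates-refl α μ ν = cong₂ _xor_ (xor-same (α <ᵇ μ)) (xor-same (α <ᵇ ν))

separates-same : ∀ α β μ → separates α β μ μ ≡ false
separates-same α β μ = xor-same (between α β μ)

separates-symˡ : ∀ α β μ ν → separates α β μ ν ≡ separates β α μ ν
separates-symˡ α β μ ν = cong₂ _xor_ (xor-comm (α <ᵇ μ) _) (xor-comm (α <ᵇ ν) _)

separates-symʳ : ∀ α β μ ν → separates α β μ ν ≡ separates α β ν μ
separates-symʳ α β μ ν = xor-comm (between α β μ) _

between-trans : ∀ α β γ ξ → between α γ ξ ≡ between α β ξ xor between β γ ξ
between-trans α β γ ξ = sym (xor-telescope (α <ᵇ ξ) (β <ᵇ ξ) (γ <ᵇ ξ))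

separates-transˡ : ∀ α β γ μ ν → separates α γ μ ν ≡ separates α β μ ν xor separates β γ μ ν
separates-transˡ α β γ μ ν =
  trans (cong₂ _xor_ (between-trans α β γ μ) (between-trans α β γ ν))
        (interchange (between α β μ) (between β γ μ) (between α β ν) (between β γ ν))

separates-transʳ : ∀ α β μ κ ν → separates α β μ ν ≡ separates α β μ κ xor separates α β κ ν
separates-transʳ α β μ κ ν = sym (xor-telescope (between α β μ) (between α β κ) (between α β ν))

<ᵇ-xor-flip : ∀ {x y} → x ≢ y → (x <ᵇ y) xor (y <ᵇ x) ≡ true
<ᵇ-xor-flip {x} {y} x≢y with <-cmp x y
... | tri< x<y _ _ = cong₂ _xor_ (dec-true (x <? y) x<y) (dec-false (y <? x) (<⇒≯ x<y))
... | tri≈ _ x≡y _ = contradiction x≡y x≢y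
... | tri> _ _ y<x = cong₂ _xor_ (dec-false (x <? y) (<⇒≯ y<x)) (dec-true (y <? x) y<x)

between-swap : ∀ α {β γ} → β ≢ γ →
               between α β γ xor between α γ β ≡ not ((α <ᵇ β) xor (α <ᵇ γ))
between-swap α {β} {γ} β≢γ = begin
  (a γ xor (β <ᵇ γ)) xor (a β xor (γ <ᵇ β))  ≡⟨ interchange (a γ) _ (a β) _ ⟩
  (a γ xor a β) xor ((β <ᵇ γ) xor (γ <ᵇ β))  ≡⟨ cong ((a γ xor a β) xor_) (<ᵇ-xor-flip β≢γ) ⟩
  (a γ xor a β) xor true                          ≡⟨ xor-comm (a γ xor a β) true ⟩
  not (a γ xor a β)                               ≡⟨ cong not (xor-comm (a γ) (a β)) ⟩
  not (a β xor a γ)                               ∎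
  where
  open ≡-Reasoning
  a : ℕ → Bool
  a ξ = α <ᵇ ξ

four-points : ∀ α {β γ δ} → β ≢ γ → β ≢ δ → γ ≢ δ →
              (separates α β γ δ xor separates α γ β δ) xor separates α δ β γ ≡ true
four-points α {β} {γ} {δ} β≢γ β≢δ γ≢δ = begin
  ((b β γ xor b β δ) xor (b γ β xor b γ δ)) xor (b δ β xor b δ γ)
    ≡⟨ cong (_xor (b δ β xor b δ γ)) (interchange (b β γ) _ _ _) ⟩
  ((b β γ xor b γ β) xor (b β δ xor b γ δ)) xor (b δ β xor b δ γ)
    ≡⟨ xor-assoc (b β γ xor b γ β) _ _ ⟩
  (b β γ xor b γ β) xor ((b β δ xor b γ δ) xor (b δ β xor b δ γ))
    ≡⟨ cong ((b β γ xor b γ β) xor_) (interchange (b β δ) _ _ _) ⟩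
  (b β γ xor b γ β) xor ((b β δ xor b δ β) xor (b γ δ xor b δ γ))
    ≡⟨ cong₂ _xor_ (between-swap α β≢γ) (cong₂ _xor_ (between-swap α β≢δ) (between-swap α γ≢δ)) ⟩
  not (a β xor a γ) xor (not (a β xor a δ) xor not (a γ xor a δ))
    ≡⟨ cong (not (a β xor a γ) xor_) (trans (xor-annihilates-not (a β xor a δ) _) (xor-cancelʳ (a β) (a γ) (a δ))) ⟩
  not (a β xor a γ) xor (a β xor a γ)
    ≡⟨ xor-inverseˡ (a β xor a γ) ⟩
  true ∎
  where
  open ≡-Reasoning
  a : ℕ → Bool
  a ξ = α <ᵇ ξ
  b : ℕ → ℕ → Bool
  b ξ ζ = between α ξ ζ

between-inside : ∀ {α β ξ} → α < ξ → ξ < β → between α β ξ ≡ true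
between-inside {α} {β} {ξ} α<ξ ξ<β = cong₂ _xor_ (dec-true (α <? ξ) α<ξ) (dec-false (β <? ξ) (<⇒≯ ξ<β))

between-outside : ∀ {α β ξ} → α < β → ξ < α ⊎ β < ξ → between α β ξ ≡ false
between-outside {α} {β} {ξ} α<β (inj₁ ξ<α) =
  cong₂ _xor_ (dec-false (α <? ξ) (<⇒≯ ξ<α)) (dec-false (β <? ξ) (<⇒≯ (<-trans ξ<α α<β)))
between-outside {α} {β} {ξ} α<β (inj₂ β<ξ) =
  cong₂ _xor_ (dec-true (α <? ξ) (<-trans α<β β<ξ)) (dec-true (β <? ξ) β<ξ)

inside-or-outside : ∀ {α β ξ} → α < β → ξ ≢ α → ξ ≢ β → (α < ξ × ξ < β) ⊎ (ξ < α ⊎ β < ξ)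
inside-or-outside {α} {β} {ξ} α<β ξ≢α ξ≢β with <-cmp ξ α | <-cmp ξ β
... | tri< ξ<α _ _ | _             = inj₂ (inj₁ ξ<α)
... | tri≈ _ ξ≡α _ | _             = contradiction ξ≡α ξ≢α
... | tri> _ _ α<ξ | tri< ξ<β _ _  = inj₁ (α<ξ , ξ<β)
... | tri> _ _ _   | tri≈ _ ξ≡β _  = contradiction ξ≡β ξ≢β
... | tri> _ _ _   | tri> _ _ β<ξ  = inj₂ (inj₂ β<ξ)

adjacent-sym : ∀ {V} (G : Graph V) {u v} → adj G u v ≡ true → adj G v u ≡ true
adjacent-sym G {u} {v} uv = trans (adj-sym G v u) uv

adjacent⇒≢ : ∀ {V} (G : Graph V) {u v} → adj G u v ≡ true → u ≢ v
adjacent⇒≢ G {u} uv refl = contradiction (trans (sym uv) (adj-irrefl G u)) λ ()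

data Walk {V : ℕ} (G : Graph V) (u : Fin V) : Fin V → Set where
  []  : Walk G u u
  _▷_ : ∀ {v w} → Walk G u v → adj G v w ≡ true → Walk G u w

vertices : ∀ {V} {G : Graph V} {u v} → Walk G u v → List (Fin V)
vertices {u = u} []         = u ∷ []
vertices (_▷_ {w = w} W _) = w ∷ vertices W

end∈vertices : ∀ {V} {G : Graph V} {u v} (W : Walk G u v) → v ∈ vertices W
end∈vertices []      = here refl
end∈vertices (W ▷ _) = here refl

module OuterplanarDrawing {V : ℕ} (G : Graph V) (drawing : Outerplanar G) where

  pos : Fin V → ℕ
  pos v = toℕ (proj₁ drawing v)

  pos-injective : ∀ {u v} → pos u ≡ pos v → u ≡ v
  pos-injective = proj₁ (proj₂ drawing) ∘ toℕ-injective

  edge-stays-on-side : ∀ {a b u v} → adj G a b ≡ true → adj G u v ≡ true →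
                       pos a < pos u → pos u < pos b →
                       pos v < pos a ⊎ pos b < pos v → ⊥
  edge-stays-on-side ab uv a<u u<b (inj₁ v<a) =
    proj₂ (proj₂ drawing) _ _ _ _ (adjacent-sym G uv) ab (v<a , a<u , u<b)
  edge-stays-on-side ab uv a<u u<b (inj₂ b<v) =
    proj₂ (proj₂ drawing) _ _ _ _ ab uv (a<u , u<b , b<v)

  disjoint-edges-do-not-cross-ordered : ∀ {a b u v} → adj G a b ≡ true → adj G u v ≡ true →
    pos a < pos b → u ≢ a → u ≢ b → v ≢ a → v ≢ b →
    separates (pos a) (pos b) (pos u) (pos v) ≡ false
  disjoint-edges-do-not-cross-ordered ab uv a<b u≢a u≢b v≢a v≢b
    with inside-or-outside a<b (u≢a ∘ pos-injective) (u≢b ∘ pos-injective)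
       | inside-or-outside a<b (v≢a ∘ pos-injective) (v≢b ∘ pos-injective)
  ... | inj₁ (a<u , u<b) | inj₁ (a<v , v<b) =
    cong₂ _xor_ (between-inside a<u u<b) (between-inside a<v v<b)
  ... | inj₂ u-out | inj₂ v-out =
    cong₂ _xor_ (between-outside a<b u-out) (between-outside a<b v-out)
  ... | inj₁ (a<u , u<b) | inj₂ v-out = ⊥-elim (edge-stays-on-side ab uv a<u u<b v-out)
  ... | inj₂ u-out | inj₁ (a<v , v<b) =
    ⊥-elim (edge-stays-on-side ab (adjacent-sym G uv) a<v v<b u-out)

  disjoint-edges-do-not-cross : ∀ {a b u v} → adj G a b ≡ true → adj G u v ≡ true →
    u ≢ a → u ≢ b → v ≢ a → v ≢ b →
    separates (pos a) (pos b) (pos u) (pos v) ≡ false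
  disjoint-edges-do-not-cross {a} {b} {u} {v} ab uv u≢a u≢b v≢a v≢b with <-cmp (pos a) (pos b)
  ... | tri< a<b _ _ = disjoint-edges-do-not-cross-ordered ab uv a<b u≢a u≢b v≢a v≢b
  ... | tri≈ _ a≡b _ = contradiction (pos-injective a≡b) (adjacent⇒≢ G ab)
  ... | tri> _ _ b<a = trans (separates-symˡ (pos a) (pos b) (pos u) (pos v))
    (disjoint-edges-do-not-cross-ordered (adjacent-sym G ab) uv b<a u≢b u≢a v≢b v≢a)

  edge-and-walk-do-not-cross : ∀ {a b u v} → adj G a b ≡ true → (W : Walk G u v) →
    a ∉ vertices W → b ∉ vertices W →
    separates (pos a) (pos b) (pos u) (pos v) ≡ false
  edge-and-walk-do-not-cross {a} {b} {u} ab [] a∉W b∉W = separates-same (pos a) (pos b) (pos u)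
  edge-and-walk-do-not-cross {a} {b} {u} ab (_▷_ {v} {w} W vw) a∉W b∉W = begin
    separates (pos a) (pos b) (pos u) (pos w)
      ≡⟨ separates-transʳ (pos a) (pos b) (pos u) (pos v) (pos w) ⟩
    separates (pos a) (pos b) (pos u) (pos v) xor
    separates (pos a) (pos b) (pos v) (pos w)
      ≡⟨ cong₂ _xor_ (edge-and-walk-do-not-cross ab W (a∉W ∘ there) (b∉W ∘ there))
                     (disjoint-edges-do-not-cross ab vw (avoids a∉W) (avoids b∉W)
                                                      (a∉W ∘ here ∘ sym) (b∉W ∘ here ∘ sym)) ⟩
    false ∎
    where
    open ≡-Reasoning
    avoids : ∀ {x} → x ∉ vertices (W ▷ vw) → v ≢ x
    avoids x∉ refl = x∉ (there (end∈vertices W))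

  disjoint-walks-do-not-cross : ∀ {a b u v} (W₁ : Walk G a b) (W₂ : Walk G u v) →
    Disjoint (vertices W₁) (vertices W₂) →
    separates (pos a) (pos b) (pos u) (pos v) ≡ false
  disjoint-walks-do-not-cross {a} {_} {u} {v} [] W₂ _ = separates-refl (pos a) (pos u) (pos v)
  disjoint-walks-do-not-cross {a} {_} {u} {v} (_▷_ {b} {c} W₁ bc) W₂ W₁#W₂ = begin
    separates (pos a) (pos c) (pos u) (pos v)
      ≡⟨ separates-transˡ (pos a) (pos b) (pos c) (pos u) (pos v) ⟩
    separates (pos a) (pos b) (pos u) (pos v) xor
    separates (pos b) (pos c) (pos u) (pos v)
      ≡⟨ cong₂ _xor_ (disjoint-walks-do-not-cross W₁ W₂ (λ (x∈W₁ , x∈W₂) → W₁#W₂ (there x∈W₁ , x∈W₂)))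
                     (edge-and-walk-do-not-cross bc W₂ (λ b∈W₂ → W₁#W₂ (there (end∈vertices W₁) , b∈W₂))
                                                       (λ c∈W₂ → W₁#W₂ (here refl , c∈W₂))) ⟩
    false ∎
    where open ≡-Reasoning

NoCrossingIn : (ℕ → ℕ → Bool) → ℕ → ℕ → Set
NoCrossingIn A lo hi = ∀ {a c b d} → lo ≤ a → a < c → c < b → b < d → d ≤ hi →
                       A a b ≡ true → A c d ≡ true → ⊥

∸-split : ∀ {lo m hi} → lo ≤ m → m ≤ hi → hi ∸ lo ≡ (m ∸ lo) + (hi ∸ m)
∸-split z≤n       m≤hi      = sym (m+[n∸m]≡n m≤hi)
∸-split (s≤s lo≤m) (s≤s m≤hi) = ∸-split lo≤m m≤hi

+-≤-2^ : ∀ {x y a b c} → x ≤ 2 ^ a → y ≤ 2 ^ b → a < c → b < c → x + y ≤ 2 ^ c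
+-≤-2^ {x} {y} {a} {b} {suc c} x≤2^a y≤2^b (s≤s a≤c) (s≤s b≤c) = begin
  x + y          ≤⟨ +-mono-≤ (≤-trans x≤2^a (^-monoʳ-≤ 2 a≤c)) (≤-trans y≤2^b (^-monoʳ-≤ 2 b≤c)) ⟩
  2 ^ c + 2 ^ c  ≡⟨ cong (2 ^ c +_) (sym (+-identityʳ (2 ^ c))) ⟩
  2 ^ suc c      ∎
  where open ≤-Reasoning

≤-⊔ᴸˡ : ∀ {X : Set} (f : X → ℕ) x y → f x ≤ f (⊔ᴸ f x y)
≤-⊔ᴸˡ f x y = ⊔ᴸ-presᵒ-v≤ f x y (inj₁ ≤-refl)

≤-⊔ᴸʳ : ∀ {X : Set} (f : X → ℕ) x y → f y ≤ f (⊔ᴸ f x y)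
≤-⊔ᴸʳ f x y = ⊔ᴸ-presᵒ-v≤ f x y (inj₂ ≤-refl)

record Last (f : ℕ → Bool) (lo hi : ℕ) : Set where
  field
    point    : ℕ
    lo≤point : lo ≤ point
    point<hi : point < hi
    holds    : f point ≡ true
    after    : ∀ {u} → point < u → u < hi → f u ≡ false

open Last

Last-step : ∀ {f lo hi} → Last f lo hi → f hi ≡ false → Last f lo (suc hi)
Last-step {f} {hi = hi} ℓ f-hi = record
  { point = point ℓ ; lo≤point = lo≤point ℓ ; point<hi = m<n⇒m<1+n (point<hi ℓ) ; holds = holds ℓ
  ; after = after′ }
  where
  after′ : ∀ {u} → point ℓ < u → u < suc hi → f u ≡ false
  after′ p<u u<1+hi with m≤n⇒m<n∨m≡n (≤-pred u<1+hi)
  ... | inj₁ u<hi = after ℓ p<u u<hi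
  ... | inj₂ refl = f-hi

last : ∀ f {lo hi} → lo < hi → f lo ≡ true → Last f lo hi
last f {lo} {suc h} lo<1+h f-lo with f h in f-h
... | true = record
  { point = h ; lo≤point = ≤-pred lo<1+h ; point<hi = n<1+n h ; holds = f-h
  ; after = λ h<u u<1+h → contradiction (≤-pred u<1+h) (<⇒≱ h<u) }
... | false with m≤n⇒m<n∨m≡n (≤-pred lo<1+h)
...   | inj₁ lo<h = Last-step (last f lo<h f-lo) f-h
...   | inj₂ refl = contradiction (trans (sym f-lo) f-h) λ ()

[_,_⟩ : ℕ → ℕ → ℕ → Set
[ lo , hi ⟩ w = lo ≤ w × w < hi

⟨_,_] : ℕ → ℕ → ℕ → Set
⟨ lo , hi ] w = lo < w × w ≤ hi

module InducedPaths (A : ℕ → ℕ → Bool) (A-sym : ∀ i j → A i j ≡ A j i)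
  (A-irrefl : ∀ i → A i i ≡ false) (N : ℕ) (A-step : ∀ {i} → suc i < N → A i (suc i) ≡ true)
  (no-crossing-under-edges : ∀ {t z} → z < N → A t z ≡ true → NoCrossingIn A t z) where

  A-≢ : ∀ {x y} → A x y ≡ true → x ≢ y
  A-≢ {x} xy refl = contradiction (trans (sym xy) (A-irrefl x)) λ ()

  NoCrossingIn-mono : ∀ {lo hi lo′ hi′} → lo ≤ lo′ → hi′ ≤ hi → NoCrossingIn A lo hi → NoCrossingIn A lo′ hi′
  NoCrossingIn-mono lo≤lo′ hi′≤hi no-crossing lo′≤a a<c c<b b<d d≤hi′ =
    no-crossing (≤-trans lo≤lo′ lo′≤a) a<c c<b b<d (≤-trans d≤hi′ hi′≤hi)

  Apart : ℕ → ℕ → Set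
  Apart x w = A x w ≡ false × x ≢ w

  IsInducedPath : List ℕ → Set
  IsInducedPath []           = ⊤
  IsInducedPath (x ∷ [])     = ⊤
  IsInducedPath (x ∷ y ∷ ys) = A x y ≡ true × All (Apart x) ys × IsInducedPath (y ∷ ys)

  IsInducedPath-tail : ∀ {x xs} → IsInducedPath (x ∷ xs) → IsInducedPath xs
  IsInducedPath-tail {xs = []}    _           = tt
  IsInducedPath-tail {xs = _ ∷ _} (_ , _ , p) = p

  head-distinct : ∀ {x xs} → IsInducedPath (x ∷ xs) → All (x ≢_) xs
  head-distinct {xs = []}    _                  = []
  head-distinct {xs = _ ∷ _} (xy , x-apart , _) = A-≢ xy ∷ All.map proj₂ x-apart

  record InducedPathFrom (s : ℕ) (P : ℕ → Set) : Set where
    field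
      rest    : List ℕ
      induced : IsInducedPath (s ∷ rest)
      within  : All P (s ∷ rest)

    size : ℕ
    size = length (s ∷ rest)

  open InducedPathFrom

  rest-within : ∀ {s P} (π : InducedPathFrom s P) → All (λ w → P w × s ≢ w) (rest π)
  rest-within π = All.zip (All.tail (within π) , head-distinct (induced π))

  singleton : ∀ {s P} → P s → InducedPathFrom s P
  singleton Ps = record { rest = [] ; induced = tt ; within = Ps ∷ [] }

  widen : ∀ {s P Q} → P ⊆ Q → InducedPathFrom s P → InducedPathFrom s Q
  widen P⊆Q π = record { rest = rest π ; induced = induced π ; within = All.map P⊆Q (within π) }

  prepend : ∀ {x y P} → P x → A x y ≡ true → (π : InducedPathFrom y P) → All (Apart x) (rest π) →
            InducedPathFrom x P
  prepend {y = y} Px xy π x-apart = record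
    { rest = y ∷ rest π ; induced = xy , x-apart , induced π ; within = Px ∷ within π }

  cons-last-neighbour : ∀ {x hi} (ℓ : Last (A x) (suc x) hi) → InducedPathFrom (point ℓ) [ point ℓ , hi ⟩ →
           InducedPathFrom x [ x , hi ⟩
  cons-last-neighbour {x} {hi} ℓ π = prepend (≤-refl , <-trans x<z (point<hi ℓ)) (holds ℓ)
                          (widen (λ (z≤w , w<hi) → ≤-trans (<⇒≤ x<z) z≤w , w<hi) π)
                          (All.map apart (rest-within π))
    where
    x<z : x < point ℓ
    x<z = lo≤point ℓ
    apart : ∀ {w} → [ point ℓ , hi ⟩ w × point ℓ ≢ w → Apart x w
    apart ((z≤w , w<hi) , z≢w) = after ℓ (≤∧≢⇒< z≤w z≢w) w<hi , <⇒≢ (<-≤-trans x<z z≤w)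

  Shadowed : ℕ → ℕ → ℕ → Set
  Shadowed a b w = w < a × (∀ {u} → a < u → u ≤ b → A w u ≡ false)

  Shadowed⇒Apart : ∀ {a b x w} → a < x → x ≤ b → Shadowed a b w → Apart x w
  Shadowed⇒Apart {x = x} {w} a<x x≤b (w<a , blind) =
    trans (A-sym x w) (blind a<x x≤b) , ≢-sym (<⇒≢ (<-trans w<a a<x))

  climb : ∀ {a b P} → Acc _<_ (b ∸ a) → a < b → b < N → (∀ {u} → a < u → u ≤ b → P u) →
          (π : InducedPathFrom a P) → All (Shadowed a b) (rest π) →
          Σ (InducedPathFrom b P) λ ρ → size π < size ρ
  climb {a} {b} (acc smaller) a<b b<N P-above π shadowed with A a b in ab
  ... | true  = prepend (P-above a<b ≤-refl) (trans (A-sym b a) ab) π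
                  (All.map (Shadowed⇒Apart a<b ≤-refl) shadowed) , n<1+n (size π)
  ... | false = proj₁ climbed , <-trans (n<1+n (size π)) (proj₂ climbed)
    where
    a+1<b : suc a < b
    a+1<b = ≤∧≢⇒< a<b λ { refl → contradiction (trans (sym ab) (A-step b<N)) λ () }
    ℓ = last (A a) a+1<b (A-step (<-trans a+1<b b<N))
    z = point ℓ
    a<z : a < z
    a<z = lo≤point ℓ
    z<b : z < b
    z<b = point<hi ℓ
    a-shadowed : Shadowed z b a
    a-shadowed = a<z , λ z<u u≤b → [ after ℓ z<u , (λ { refl → ab }) ] (m≤n⇒m<n∨m≡n u≤b)
    still-shadowed : ∀ {w} → Shadowed a b w → Shadowed z b w
    still-shadowed (w<a , blind) = <-trans w<a a<z , λ z<u → blind (<-trans a<z z<u)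
    climbed = climb (smaller (∸-monoʳ-< a<z (<⇒≤ z<b))) z<b b<N (P-above ∘ <-trans a<z)
                (prepend (P-above a<z (<⇒≤ z<b)) (trans (A-sym z a) (holds ℓ)) π
                   (All.map (Shadowed⇒Apart a<z (<⇒≤ z<b)) shadowed))
                (a-shadowed ∷ All.map still-shadowed shadowed)

  record Pocket (lo hi : ℕ) : Set where
    field
      left  : InducedPathFrom lo [ lo , hi ⟩
      right : InducedPathFrom hi ⟨ lo , hi ]
      width : hi ∸ lo ≤ 2 ^ (size left + size right)

  open Pocket

  -- A vertex strictly between lo and z that saw beyond z would give an edge crossing lo z.
  climb-out-of-pocket : ∀ {lo hi} → hi < N → NoCrossingIn A lo hi → (ℓ : Last (A lo) (suc lo) hi) →
    (π : InducedPathFrom (point ℓ) ⟨ lo , point ℓ ]) → Σ (InducedPathFrom hi ⟨ lo , hi ]) λ ρ → size π < size ρ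
  climb-out-of-pocket {lo} {hi} hi<N no-crossing ℓ π =
    climb (<-wellFounded _) (point<hi ℓ) hi<N (λ z<u u≤hi → <-trans lo<z z<u , u≤hi)
      (widen (λ (lo<w , w≤z) → lo<w , ≤-trans w≤z (<⇒≤ (point<hi ℓ))) π)
      (All.map shadowed (rest-within π))
    where
    lo<z : lo < point ℓ
    lo<z = lo≤point ℓ
    shadowed : ∀ {w} → ⟨ lo , point ℓ ] w × point ℓ ≢ w → Shadowed (point ℓ) hi w
    shadowed ((lo<w , w≤z) , z≢w) = w<z , λ z<u u≤hi →
      ¬-not λ wu → no-crossing ≤-refl lo<w w<z z<u u≤hi (holds ℓ) wu
      where
      w<z = ≤∧≢⇒< w≤z (≢-sym z≢w)

  pocket : ∀ {lo hi} → Acc _<_ (hi ∸ lo) → lo < hi → hi < N → NoCrossingIn A lo hi → Pocket lo hi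
  pocket {lo} {hi} (acc smaller) lo<hi hi<N no-crossing with m≤n⇒m<n∨m≡n lo<hi
  ... | inj₂ refl = record
    { left  = singleton (≤-refl , lo<hi)
    ; right = singleton (lo<hi , ≤-refl)
    ; width = ≤-trans (≤-reflexive (m+n∸n≡m 1 lo)) (s≤s z≤n) }
  ... | inj₁ lo+1<hi = record
    { left  = ⊔ᴸ size L₁ L₂
    ; right = ⊔ᴸ size R₁ R₂
    ; width = begin
        hi ∸ lo                    ≡⟨ ∸-split (<⇒≤ lo<z) (<⇒≤ z<hi) ⟩
        (z ∸ lo) + (hi ∸ z)        ≤⟨ +-≤-2^ (width below) (width above)
                                        (+-mono-≤-< (≤-⊔ᴸˡ size L₁ L₂) (<-≤-trans (proj₂ climbed) (≤-⊔ᴸʳ size R₁ R₂)))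
                                        (+-mono-<-≤ (≤-⊔ᴸʳ size L₁ L₂) (≤-⊔ᴸˡ size R₁ R₂)) ⟩
        2 ^ (size (⊔ᴸ size L₁ L₂) + size (⊔ᴸ size R₁ R₂)) ∎ }
    where
    open ≤-Reasoning
    ℓ = last (A lo) lo+1<hi (A-step (<-trans lo+1<hi hi<N))
    z = point ℓ
    lo<z : lo < z
    lo<z = lo≤point ℓ
    z<hi : z < hi
    z<hi = point<hi ℓ
    below = pocket (smaller (∸-monoˡ-< z<hi (<⇒≤ lo<z))) lo<z (<-trans z<hi hi<N)
              (NoCrossingIn-mono ≤-refl (<⇒≤ z<hi) no-crossing)
    above = pocket (smaller (∸-monoʳ-< lo<z (<⇒≤ z<hi))) z<hi hi<N
              (NoCrossingIn-mono (<⇒≤ lo<z) ≤-refl no-crossing)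
    climbed = climb-out-of-pocket hi<N no-crossing ℓ (right below)
    L₁ = widen (λ (lo≤w , w<z) → lo≤w , <-trans w<z z<hi) (left below)
    L₂ = cons-last-neighbour ℓ (left above)
    R₁ = widen (λ (z<w , w≤hi) → <-trans lo<z z<w , w≤hi) (right above)
    R₂ = proj₁ climbed

  SomeInducedPath : (ℕ → Set) → Set
  SomeInducedPath P = Σ ℕ λ s → InducedPathFrom s P

  some-size : ∀ {P} → SomeInducedPath P → ℕ
  some-size = size ∘ proj₂

  record Suffix (t : ℕ) : Set where
    field
      initial : InducedPathFrom t [ t , N ⟩
      other   : SomeInducedPath (_< N)
      bound   : N ∸ t ≤ 2 ^ suc (size initial + some-size other)

  open Suffix

  suffix : ∀ {t} → Acc _<_ (N ∸ t) → t < N → Suffix t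
  suffix {t} (acc smaller) t<N with m≤n⇒m<n∨m≡n t<N
  ... | inj₂ refl = record
    { initial = singleton (≤-refl , t<N)
    ; other   = t , singleton t<N
    ; bound   = ≤-trans (≤-reflexive (m+n∸n≡m 1 t)) (s≤s z≤n) }
  ... | inj₁ t+1<N = record
    { initial = ⊔ᴸ size E₁ E₂
    ; other   = ⊔ᴸ some-size F₁ F₂
    ; bound   = begin
        N ∸ t                ≡⟨ ∸-split (<⇒≤ t<z) (<⇒≤ z<N) ⟩
        (z ∸ t) + (N ∸ z)    ≤⟨ +-≤-2^ (width below) (bound beyond)
                                  (s≤s (+-mono-≤ (≤-⊔ᴸˡ size E₁ E₂) (≤-⊔ᴸˡ some-size F₁ F₂)))
                                  (s≤s (+-mono-<-≤ (≤-⊔ᴸʳ size E₁ E₂) (≤-⊔ᴸʳ some-size F₁ F₂))) ⟩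
        2 ^ suc (size (⊔ᴸ size E₁ E₂) + some-size (⊔ᴸ some-size F₁ F₂)) ∎ }
    where
    open ≤-Reasoning
    ℓ = last (A t) t+1<N (A-step t+1<N)
    z = point ℓ
    t<z : t < z
    t<z = lo≤point ℓ
    z<N : z < N
    z<N = point<hi ℓ
    below  = pocket (<-wellFounded _) t<z z<N (no-crossing-under-edges z<N (holds ℓ))
    beyond = suffix (smaller (∸-monoʳ-< t<z (<⇒≤ z<N))) z<N
    E₁ = widen (λ (t≤w , w<z) → t≤w , <-trans w<z z<N) (left below)
    E₂ = cons-last-neighbour ℓ (initial beyond)
    F₁ : SomeInducedPath (_< N)
    F₁ = z , widen (λ (_ , w≤z) → ≤-<-trans w≤z z<N) (right below)
    F₂ = other beyond

  long-induced-path : 0 < N → Σ (SomeInducedPath (_< N)) λ π → N ≤ 2 ^ suc (2 * some-size π)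
  long-induced-path 0<N = longest , (begin
    N                                         ≤⟨ bound whole ⟩
    2 ^ suc (size (initial whole) + some-size (other whole))
      ≤⟨ ^-monoʳ-≤ 2 (s≤s (+-mono-≤ (≤-⊔ᴸˡ some-size E F) (≤-⊔ᴸʳ some-size E F))) ⟩
    2 ^ suc (some-size longest + some-size longest)
      ≡⟨ cong (λ k → 2 ^ suc (some-size longest + k)) (sym (+-identityʳ (some-size longest))) ⟩
    2 ^ suc (2 * some-size longest) ∎)
    where
    open ≤-Reasoning
    whole = suffix (<-wellFounded N) 0<N
    E : SomeInducedPath (_< N)
    E = 0 , widen proj₂ (initial whole)
    F = other whole
    longest = ⊔ᴸ some-size E F

  lookup-injective : ∀ {xs} → IsInducedPath xs → Injective _≡_ _≡_ (lookup xs)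
  lookup-injective {_ ∷ _} p {zero}  {zero}  _  = refl
  lookup-injective {_ ∷ _} p {zero}  {suc j} eq = contradiction eq (All.lookup (head-distinct p) (∈-lookup j))
  lookup-injective {_ ∷ _} p {suc i} {zero}  eq =
    contradiction (sym eq) (All.lookup (head-distinct p) (∈-lookup i))
  lookup-injective {_ ∷ _} p {suc i} {suc j} eq = cong suc (lookup-injective (IsInducedPath-tail p) eq)

  head-adjacent⇔consecutive : ∀ {x xs} → IsInducedPath (x ∷ xs) → (j : Fin (length (x ∷ xs))) →
    A x (lookup (x ∷ xs) j) ≡ true ⇔ Consecutive zero j
  head-adjacent⇔consecutive {x} p zero =
    mk⇔ (λ xx → contradiction (trans (sym xx) (A-irrefl x)) λ ()) λ { (inj₁ ()) ; (inj₂ ()) }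
  head-adjacent⇔consecutive {xs = y ∷ ys} (xy , _ , _) (suc zero) = mk⇔ (λ _ → inj₁ refl) (λ _ → xy)
  head-adjacent⇔consecutive {xs = y ∷ ys} (_ , x-apart , _) (suc (suc j)) =
    mk⇔ (λ xw → contradiction (trans (sym xw) (proj₁ (All.lookup x-apart (∈-lookup j)))) λ ())
        λ { (inj₁ ()) ; (inj₂ ()) }

  lookup-adjacent⇔consecutive : ∀ {xs} → IsInducedPath xs → (i j : Fin (length xs)) →
    A (lookup xs i) (lookup xs j) ≡ true ⇔ Consecutive i j
  lookup-adjacent⇔consecutive {_ ∷ _} p zero j = head-adjacent⇔consecutive p j
  lookup-adjacent⇔consecutive {x ∷ xs} p (suc i) zero =
    mk⇔ (Sum.swap ∘ to ∘ trans (A-sym x _)) (trans (A-sym _ x) ∘ from ∘ Sum.swap)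
    where open Equivalence (head-adjacent⇔consecutive p (suc i))
  lookup-adjacent⇔consecutive {x ∷ xs} p (suc i) (suc j) =
    mk⇔ (Sum.map (cong suc) (cong suc) ∘ to) (from ∘ Sum.map suc-injective suc-injective)
    where open Equivalence (lookup-adjacent⇔consecutive (IsInducedPath-tail p) i j)

module AlongPath {V : ℕ} (G : Graph V) (drawing : Outerplanar G) (n : ℕ) (path : HasPath G (suc n)) where

  open OuterplanarDrawing G drawing

  N : ℕ
  N = suc n

  -- Indices are taken modulo N only to make vertex total; it is used on indices below N.
  vertex : ℕ → Fin V
  vertex i = proj₁ path (i mod N)

  toℕ-mod : ∀ {i} → i < N → toℕ (i mod N) ≡ i
  toℕ-mod i<N = trans (toℕ-fromℕ< _) (m<n⇒m%n≡m i<N)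

  vertex-injective : ∀ {i j} → i < N → j < N → vertex i ≡ vertex j → i ≡ j
  vertex-injective i<N j<N eq =
    trans (sym (toℕ-mod i<N)) (trans (cong toℕ (proj₁ (proj₂ path) eq)) (toℕ-mod j<N))

  vertex-≢ : ∀ {i j} → i < j → j < N → vertex i ≢ vertex j
  vertex-≢ i<j j<N = <⇒≢ i<j ∘ vertex-injective (<-trans i<j j<N) j<N

  vertex-step : ∀ {i} → suc i < N → adj G (vertex i) (vertex (suc i)) ≡ true
  vertex-step {i} 1+i<N = proj₂ (proj₂ path) _ _
    (inj₁ (trans (cong suc (toℕ-mod (<-trans (n<1+n i) 1+i<N))) (sym (toℕ-mod 1+i<N))))

  segment : ∀ {i j} → i ≤′ j → j < N → Walk G (vertex i) (vertex j)
  segment ≤′-refl               _     = []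
  segment (≤′-step {j} i≤′j) 1+j<N = segment i≤′j (<-trans (n<1+n j) 1+j<N) ▷ vertex-step 1+j<N

  ∈-segment : ∀ {i j x} (i≤′j : i ≤′ j) (j<N : j < N) → x ∈ vertices (segment i≤′j j<N) →
              ∃ λ k → i ≤ k × k ≤ j × x ≡ vertex k
  ∈-segment {i} ≤′-refl _ (here x≡i) = i , ≤-refl , ≤-refl , x≡i
  ∈-segment {j = suc j} i≤′1+j@(≤′-step _) _ (here x≡1+j) = suc j , ≤′⇒≤ i≤′1+j , ≤-refl , x≡1+j
  ∈-segment (≤′-step i≤′j) _ (there x∈) with ∈-segment i≤′j _ x∈
  ... | k , i≤k , k≤j , x≡k = k , i≤k , m≤n⇒m≤1+n k≤j , x≡k

  vertex∉segment : ∀ {i j k} (i≤′j : i ≤′ j) (j<N : j < N) → k < N → k < i ⊎ j < k →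
                   vertex k ∉ vertices (segment i≤′j j<N)
  vertex∉segment i≤′j j<N k<N k-outside k∈ with ∈-segment i≤′j j<N k∈
  ... | l , i≤l , l≤j , k≡l with vertex-injective k<N (≤-<-trans l≤j j<N) k≡l
  ... | refl = [ (λ k<i → <⇒≱ k<i i≤l) , (λ j<k → <⇒≱ j<k l≤j) ] k-outside

  segments-disjoint : ∀ {i₁ j₁ i₂ j₂} (i₁≤′j₁ : i₁ ≤′ j₁) (j₁<N : j₁ < N)
                      (i₂≤′j₂ : i₂ ≤′ j₂) (j₂<N : j₂ < N) → j₁ < i₂ →
                      Disjoint (vertices (segment i₁≤′j₁ j₁<N)) (vertices (segment i₂≤′j₂ j₂<N))
  segments-disjoint i₁≤′j₁ j₁<N i₂≤′j₂ j₂<N j₁<i₂ (x∈₁ , x∈₂) with ∈-segment i₁≤′j₁ j₁<N x∈₁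
  ... | k , _ , k≤j₁ , refl =
    vertex∉segment i₂≤′j₂ j₂<N (≤-<-trans k≤j₁ j₁<N) (inj₁ (≤-<-trans k≤j₁ j₁<i₂)) x∈₂

  Edge : ℕ → ℕ → Bool
  Edge i j = adj G (vertex i) (vertex j)

  place : ℕ → ℕ
  place i = pos (vertex i)

  -- The walk d … z, z t, t … a joins the ends of the chord a d and avoids the segment c … b.
  detour-does-not-cross : ∀ {t a c b d z} → t ≤ a → a < c → c < b → b < d → d ≤ z → z < N →
    Edge t z ≡ true → separates (place a) (place d) (place b) (place c) ≡ false
  detour-does-not-cross {t} {a} {c} {b} {d} {z} t≤a a<c c<b b<d d≤z z<N tz = begin
    separates (place a) (place d) (place b) (place c)
      ≡⟨ trans (separates-symˡ (place a) (place d) (place b) (place c))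
               (separates-symʳ (place d) (place a) (place b) (place c)) ⟩
    separates (place d) (place a) (place c) (place b)
      ≡⟨ separates-transˡ (place d) (place z) (place a) (place c) (place b) ⟩
    separates (place d) (place z) (place c) (place b) xor separates (place z) (place a) (place c) (place b)
      ≡⟨ cong (separates (place d) (place z) (place c) (place b) xor_)
              (separates-transˡ (place z) (place t) (place a) (place c) (place b)) ⟩
    separates (place d) (place z) (place c) (place b) xor
    (separates (place z) (place t) (place c) (place b) xor separates (place t) (place a) (place c) (place b))
      ≡⟨ cong₂ _xor_ d…z (cong₂ _xor_ z-t t…a) ⟩
    false ∎
    where
    open ≡-Reasoning
    b<N = <-trans b<d (≤-<-trans d≤z z<N)
    a<N = <-trans a<c (<-trans c<b b<N)
    c…b = segment (≤⇒≤′ (<⇒≤ c<b)) b<N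
    d…z = disjoint-walks-do-not-cross (segment (≤⇒≤′ d≤z) z<N) c…b
            (Disjoint.sym (segments-disjoint (≤⇒≤′ (<⇒≤ c<b)) b<N (≤⇒≤′ d≤z) z<N b<d))
    z-t = edge-and-walk-do-not-cross (adjacent-sym G tz) c…b
            (vertex∉segment _ b<N z<N (inj₂ (<-≤-trans b<d d≤z)))
            (vertex∉segment _ b<N (≤-<-trans t≤a a<N) (inj₁ (≤-<-trans t≤a a<c)))
    t…a = disjoint-walks-do-not-cross (segment (≤⇒≤′ t≤a) a<N) c…b
            (segments-disjoint (≤⇒≤′ t≤a) a<N (≤⇒≤′ (<⇒≤ c<b)) b<N a<c)

  no-crossing-under-edge : ∀ {t z} → z < N → Edge t z ≡ true → NoCrossingIn Edge t z
  no-crossing-under-edge {t} {z} z<N tz {a} {c} {b} {d} t≤a a<c c<b b<d d≤z ab cd =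
    contradiction (begin
      true
        ≡⟨ sym (four-points (place a) (≢-sym (place-≢ c<b b<N)) (place-≢ b<d d<N) (place-≢ c<d d<N)) ⟩
      (separates (place a) (place b) (place c) (place d) xor
       separates (place a) (place c) (place b) (place d)) xor separates (place a) (place d) (place b) (place c)
        ≡⟨ cong₂ _xor_ (cong₂ _xor_ chords segments) (detour-does-not-cross t≤a a<c c<b b<d d≤z z<N tz) ⟩
      false ∎) λ ()
    where
    open ≡-Reasoning
    d<N = ≤-<-trans d≤z z<N
    b<N = <-trans b<d d<N
    c<N = <-trans c<b b<N
    c<d = <-trans c<b b<d
    place-≢ : ∀ {i j} → i < j → j < N → place i ≢ place j
    place-≢ i<j j<N = vertex-≢ i<j j<N ∘ pos-injective
    chords = disjoint-edges-do-not-cross ab cd (≢-sym (vertex-≢ a<c c<N)) (vertex-≢ c<b b<N)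
               (≢-sym (vertex-≢ (<-trans a<c c<d) d<N)) (≢-sym (vertex-≢ b<d d<N))
    segments = disjoint-walks-do-not-cross (segment (≤⇒≤′ (<⇒≤ a<c)) c<N) (segment (≤⇒≤′ (<⇒≤ b<d)) d<N)
                 (segments-disjoint (≤⇒≤′ (<⇒≤ a<c)) c<N (≤⇒≤′ (<⇒≤ b<d)) d<N c<b)

  Edge-sym : ∀ i j → Edge i j ≡ Edge j i
  Edge-sym i j = adj-sym G (vertex i) (vertex j)

  Edge-irrefl : ∀ i → Edge i i ≡ false
  Edge-irrefl i = adj-irrefl G (vertex i)

  open InducedPaths Edge Edge-sym Edge-irrefl N vertex-step no-crossing-under-edge
  open InducedPathFrom

  to-HasInducedPath : ∀ {s} (π : InducedPathFrom s (_< N)) → HasInducedPath G (size π)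
  to-HasInducedPath {s} π = vertex ∘ lookup (s ∷ rest π) , injective , adjacency
    where
    below-N : ∀ i → lookup (s ∷ rest π) i < N
    below-N i = All.lookup (within π) (∈-lookup i)
    injective : Injective _≡_ _≡_ (vertex ∘ lookup (s ∷ rest π))
    injective {i} {j} eq = lookup-injective (induced π) (vertex-injective (below-N i) (below-N j) eq)
    adjacency : ∀ i j → (Edge (lookup (s ∷ rest π) i) (lookup (s ∷ rest π) j) ≡ true → Consecutive i j)
                      × (Consecutive i j → Edge (lookup (s ∷ rest π) i) (lookup (s ∷ rest π) j) ≡ true)
    adjacency i j = to , from
      where open Equivalence (lookup-adjacent⇔consecutive (induced π) i j)

  outerplanar-long-induced-path : Σ ℕ λ k → HasInducedPath G k × N ≤ 2 ^ suc (2 * k)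
  outerplanar-long-induced-path =
    let (π , N≤2^[2k+1]) = long-induced-path (s≤s z≤n)
    in some-size π , to-HasInducedPath (proj₂ π) , N≤2^[2k+1]

power-bound : ∀ m n k → 2 ^ suc m ≤ n → n ≤ 2 ^ suc (2 * k) → n ^ m ≤ 2 ^ (2 * k * suc m)
power-bound m n k 2^[m+1]≤n n≤2^[2k+1] = begin
  n ^ m                  ≤⟨ ^-monoˡ-≤ m n≤2^[2k+1] ⟩
  (2 ^ suc (2 * k)) ^ m  ≡⟨ ^-*-assoc 2 (suc (2 * k)) m ⟩
  2 ^ (suc (2 * k) * m)  ≤⟨ ^-monoʳ-≤ 2 exponents ⟩
  2 ^ (2 * k * suc m)    ∎
  where
  open ≤-Reasoning
  m≤2k : m ≤ 2 * k
  m≤2k = ≮⇒≥ λ 2k<m → <⇒≱ (^-monoʳ-< 2 (s≤s (s≤s z≤n)) (s≤s 2k<m)) (≤-trans 2^[m+1]≤n n≤2^[2k+1])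
  exponents : suc (2 * k) * m ≤ 2 * k * suc m
  exponents = ≤-trans (+-monoˡ-≤ (2 * k * m) m≤2k) (≤-reflexive (sym (*-suc (2 * k) m)))

corollary7 : (m : ℕ) → Σ ℕ λ N → (n : ℕ) → N ≤ n →
    (V : ℕ) (G : Graph V) → Outerplanar G → HasPath G n →
    Σ ℕ λ k → HasInducedPath G k × (n ^ m ≤ 2 ^ (2 * k * suc m))
corollary7 m = 2 ^ suc m , induced-path
  where
  induced-path : (n : ℕ) → 2 ^ suc m ≤ n → (V : ℕ) (G : Graph V) → Outerplanar G → HasPath G n →
                 Σ ℕ λ k → HasInducedPath G k × (n ^ m ≤ 2 ^ (2 * k * suc m))
  induced-path zero 2^[m+1]≤0 _ _ _ _ = contradiction 2^[m+1]≤0 (<⇒≱ (m^n>0 2 (suc m)))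
  induced-path (suc n) 2^[m+1]≤n V G drawing path =
    let (k , induced , n≤2^[2k+1]) = AlongPath.outerplanar-long-induced-path G drawing n path
    in k , induced , power-bound m (suc n) k 2^[m+1]≤n n≤2^[2k+1]
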